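{- In a constructive meta-theory, for every inhabited type $A$, $\mathsf{OBDC}^2_A$ implies the conjunction of $\mathsf{BDC}^2_A$, $\mathsf{BDP}_A$ and $\mathsf{BEP}_A$.
   Context: Meta-theory: constructive higher-order logic with propositions $\mathbb P$ and $\mathbb N$. For $R:A\times A\to A\to\mathbb P$: "$R$ total" means for every pair $(x,y)$ there is $z$ with $R\,(x,y)\,z$; for $f:\mathbb N\to A$, $(R\circ f)\,(n,m)\,k:=R\,(f\,n,f\,m)\,(f\,k)$, and "$R\circ f$ total" means for all $n,m$ there is $k$ with $(R\circ f)(n,m)\,k$. - $\mathsf{OBDC}^2_A$: for every $R:A\times A\to A\to\mathbb P$ there is $f:\mathbb N\to A$ with ($R$ total $\leftrightarrow$ $R\circ f$ total). - $\mathsf{BDC}^2_A$: for every total $R:A\times A\to A\to\mathbb P$ there is $f:\mathbb N\to A$ with $R\circ f$ total. - $\mathsf{BDP}_A$: for every $P:A\to\mathbb P$ there is $f:\mathbb N\to A$ with $(\forall n.\,P(f\,n))\to\forall x.\,P\,x$. - $\mathsf{BEP}_A$: for every $P:A\to\mathbb P$ there is $f:\mathbb N\to A$ with $(\exists x.\,P\,x)\to\exists n.\,P(f\,n)$. -}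

module Defs where

open import Data.Nat using (ℕ)
open import Data.Product using (Σ; ∃; _×_; _,_)

-- Propositions of the meta-theory are rendered as Set (types); ℙ := Set.

Total : {A : Set} → (A × A → A → Set) → Set
Total {A} R = (p : A × A) → Σ A (λ z → R p z)

_∘²_ : {A : Set} → (A × A → A → Set) → (ℕ → A) → (ℕ × ℕ → ℕ → Set)
(R ∘² f) (n , m) k = R (f n , f m) (f k)

Total∘ : {A : Set} → (A × A → A → Set) → (ℕ → A) → Set
Total∘ R f = (p : ℕ × ℕ) → Σ ℕ (λ k → (R ∘² f) p k)

_↔_ : Set → Set → Set
P ↔ Q = (P → Q) × (Q → P)

OBDC² : Set → Set₁
OBDC² A = (R : A × A → A → Set) → Σ (ℕ → A) (λ f → Total R ↔ Total∘ R f)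

BDC² : Set → Set₁
BDC² A = (R : A × A → A → Set) → Total R → Σ (ℕ → A) (λ f → Total∘ R f)

BDP : Set → Set₁
BDP A = (P : A → Set) → Σ (ℕ → A) (λ f → ((n : ℕ) → P (f n)) → (x : A) → P x)

BEP : Set → Set₁
BEP A = (P : A → Set) → Σ (ℕ → A) (λ f → Σ A P → Σ ℕ (λ n → P (f n)))

-- Each principle is an instance of OBDC² for a suitable relation. BDC² is the forward
-- direction as it stands. For R (x , y) z := P x, totality of R is ∀ x. P x and totality
-- of R ∘ f is ∀ n. P (f n), so the backward direction is BDP. For R (x , y) z := P z, a
-- witness of ∃ x. P x makes R total, and totality of R ∘ f at (0 , 0) yields an n with P (f n).
module Submission where

open import Defs
open import Data.Nat using (zero)
open import Data.Product using (_×_; _,_; proj₂)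

OBDC²⇒BDC² : {A : Set} → OBDC² A → BDC² A
OBDC²⇒BDC² obdc R R-total = let (f , to , _) = obdc R in f , to R-total

OBDC²⇒BDP : {A : Set} → OBDC² A → BDP A
OBDC²⇒BDP {A} obdc P =
  let (f , _ , from) = obdc holdsAtFirst
  in f , λ P∘f x → proj₂ (from (λ (n , _) → zero , P∘f n) (x , x))
  where
  holdsAtFirst : A × A → A → Set
  holdsAtFirst (x , _) _ = P x

OBDC²⇒BEP : {A : Set} → OBDC² A → BEP A
OBDC²⇒BEP {A} obdc P =
  let (f , to , _) = obdc holdsAtOutput
  in f , λ (x , Px) → to (λ _ → x , Px) (zero , zero)
  where
  holdsAtOutput : A × A → A → Set
  holdsAtOutput _ z = P z

fact7p7 : (A : Set) → A → OBDC² A → BDC² A × BDP A × BEP A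
fact7p7 A _ obdc = OBDC²⇒BDC² obdc , OBDC²⇒BDP obdc , OBDC²⇒BEP obdc
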